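{- Let $G$ be a disconnected finite simple graph on $n\geq 5$ vertices with complement $G^c$. If $i(G^c)=1$, then $G^c$ has a dominating vertex $v$ (adjacent to all other vertices) such that $G^c\setminus v$ is disconnected.
   Context: For a graph $G=(V,E)$ and $X\subseteq V$ write $\bar X=V\setminus X$ and $\partial_G(X)$ for the set of edges of $G$ with one endpoint in $X$ and the other in $\bar X$. For a nonempty proper subset $X\subset V$, $i_G(X)=\frac{|\partial_G(X)|}{\min\{|X|,|\bar X|\}}$, and the isoperimetric number of $G$ is $i(G)=\min_{\emptyset\neq X\subsetneq V} i_G(X)$. The complement $G^c$ has vertex set $V$ and contains exactly the pairs of distinct vertices that are not edges of $G$. -}

module Defs where

open import Data.Bool using (Bool; true; false; not; if_then_else_; _∧_)
open import Data.Nat using (ℕ; zero; suc; _+_; _⊓_; _<_; _≤_; z<s; s<s; NonZero; >-nonZero)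
open import Data.Nat.Properties using (⊓-glb; <-≤-trans; n≤1+n)
open import Data.Fin using (Fin; zero; suc; _≟_; punchIn)
open import Data.Fin.Subset using (Subset; _∈_; _∉_; ∁; ∣_∣; Nonempty; inside; outside)
open import Data.Fin.Subset.Properties using (_∈?_)
open import Data.Vec using (Vec; []; _∷_; here; there)
open import Data.List using (List; map; allFin)
open import Data.Nat.ListAction using (sum)
open import Data.Product using (Σ; ∃; ∃-syntax; _×_; _,_)
open import Data.Integer using (+_)
open import Data.Rational using (ℚ; _/_)
open import Relation.Nullary using (¬_; yes; no; Dec)
open import Relation.Nullary.Decidable using (⌊_⌋)
open import Relation.Binary.PropositionalEquality using (_≡_; _≢_; refl)

record Graph (n : ℕ) : Set where
  field
    adj   : Fin n → Fin n → Bool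
    sym   : ∀ u v → adj u v ≡ adj v u
    irref : ∀ v → adj v v ≡ false
open Graph public

complement : ∀ {n} → Graph n → Graph n
complement {n} G = record { adj = a ; sym = s ; irref = i }
  where
  a : Fin n → Fin n → Bool
  a u v = if ⌊ u ≟ v ⌋ then false else not (adj G u v)
  s : ∀ u v → a u v ≡ a v u
  s u v with u ≟ v | v ≟ u
  ... | yes refl | yes _ = refl
  ... | yes refl | no q  = Data.Empty.⊥-elim (q refl) where import Data.Empty
  ... | no p | yes refl  = Data.Empty.⊥-elim (p refl) where import Data.Empty
  ... | no p | no q rewrite Graph.sym G u v = refl
  i : ∀ v → a v v ≡ false
  i v with v ≟ v
  ... | yes _ = refl
  ... | no p = Data.Empty.⊥-elim (p refl) where import Data.Empty

deleteVertex : ∀ {n} → Graph (suc n) → Fin (suc n) → Graph n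
deleteVertex G v = record
  { adj = λ i j → adj G (punchIn v i) (punchIn v j)
  ; sym = λ i j → Graph.sym G (punchIn v i) (punchIn v j)
  ; irref = λ i → irref G (punchIn v i) }

data Reachable {n} (G : Graph n) : Fin n → Fin n → Set where
  here : ∀ {u} → Reachable G u u
  step : ∀ {u v w} → adj G u v ≡ true → Reachable G v w → Reachable G u w

Connected : ∀ {n} → Graph n → Set
Connected {n} G = ∀ (u v : Fin n) → Reachable G u v

Disconnected : ∀ {n} → Graph n → Set
Disconnected G = ¬ Connected G

Dominating : ∀ {n} → Graph n → Fin n → Set
Dominating {n} G v = ∀ (u : Fin n) → u ≢ v → adj G v u ≡ true

-- Edge boundary size |∂_G(X)|: number of edges {u,w} with u ∈ X, w ∉ X.
-- Each such edge is counted once, via the orientation (u ∈ X, w ∈ X̄).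
crossing : ∀ {n} → Graph n → Subset n → Fin n → Fin n → ℕ
crossing G X u w with u ∈? X | w ∈? X | adj G u w
... | yes _ | no _ | true = 1
... | _     | _    | _    = 0

boundarySize : ∀ {n} → Graph n → Subset n → ℕ
boundarySize {n} G X = sum (map (λ u → sum (map (λ w → crossing G X u w) (allFin n))) (allFin n))

minSide : ∀ {n} → Subset n → ℕ
minSide X = ∣ X ∣ ⊓ ∣ ∁ X ∣

∈⇒0<∣∣ : ∀ {n} {x : Fin n} {p : Subset n} → x ∈ p → 0 < ∣ p ∣
∈⇒0<∣∣ {p = inside ∷ p} here = z<s
∈⇒0<∣∣ {p = outside ∷ p} (there x∈p) = ∈⇒0<∣∣ x∈p
∈⇒0<∣∣ {p = inside ∷ p} (there x∈p) = z<s

minSide-pos : ∀ {n} (X : Subset n) → Nonempty X → Nonempty (∁ X) → 0 < minSide X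
minSide-pos X (_ , a) (_ , b) = ⊓-glb (∈⇒0<∣∣ a) (∈⇒0<∣∣ b)

iG : ∀ {n} → Graph n → (X : Subset n) → Nonempty X → Nonempty (∁ X) → ℚ
iG G X ne pr = (+ boundarySize G X) / minSide X
  where instance _ = >-nonZero (minSide-pos X ne pr)

IsoNumberIs : ∀ {n} → Graph n → ℚ → Set
IsoNumberIs {n} G q =
  (∀ (X : Subset n) (ne : Nonempty X) (pr : Nonempty (∁ X)) → q Data.Rational.≤ iG G X ne pr)
  × (∃[ X ] Σ (Nonempty X) λ ne → Σ (Nonempty (∁ X)) λ pr → iG G X ne pr ≡ q)

module Submission where

-- Write H = Gᶜ and let X attain i(H) = 1, i.e. |∂X| = min(|X|, |∁X|).  If C is a union of
-- components of G, then H contains every edge between C and ∁C, so the two rectangles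
-- (X ∩ C) × (∁X ∩ ∁C) and (X ∩ ∁C) × (∁X ∩ C) consist of boundary edges of X; comparing their
-- total area with min(|X|, |∁X|) forces C or ∁C to be a single vertex v, which then dominates H.
-- The star of v is again a rectangle of boundary edges, of area |X| or |∁X|, hence at least |∂X|,
-- so it contains all of ∂X: apart from v, nothing joins X to ∁X, and since n ≥ 5 both sides keep
-- a vertex other than v.  The components of G exist only up to double negation, but the property
-- "v dominates and separates X from ∁X" is decidable, which makes the argument constructive.

open import Defs hiding (sym)
open import Data.Nat using (ℕ; suc; _≤_)
open import Data.Fin using (Fin)
open import Data.Product using (∃-syntax; _×_)
open import Data.Rational using (1ℚ)

open import Data.Nat.Properties hiding (_≟_)
open import Algebra.Properties.Semiring.Sum +-*-semiring
  using (sum-cong-≗; ∑-distrib-+; *-distribˡ-sum; *-distribʳ-sum)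
  renaming (sum to ∑)
open import Data.Bool.Base using (true; not; if_then_else_)
import Data.Bool.Properties as Bool
open import Data.Empty using (⊥-elim)
open import Data.Fin.Base using (zero; suc; punchIn; punchOut)
open import Data.Fin.Properties using (_≟_; any?; all?; punchIn-punchOut; punchInᵢ≢i)
open import Data.Fin.Subset
  using (Subset; inside; outside; _∈_; _∉_; ∁; _∩_; ⁅_⁆; ⊥; ∣_∣; Nonempty)
open import Data.Fin.Subset.Properties
  using ( _∈?_; ∣p∣≤n; ∣∁p∣≡n∸∣p∣; ∣⊥∣≡0; ∣⁅x⁆∣≡1; x∈⁅x⁆; x∈⁅y⁆⇒x≡y; x≢y⇒x∉⁅y⁆; ∉⊥
        ; x∈p∧x∉q⇒x∈p─q; p∩q≢∅⇒∣p─q∣<∣p∣; x∈p∩q⁺; x∈p∩q⁻; ∩-comm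
        ; x∈∁p⇒x∉p; x∉p⇒x∈∁p; x∉∁p⇒x∈p; p⊆q⇒∣p∣≤∣q∣; nonempty?; Empty-unique )
import Data.Integer as ℤ
import Data.Integer.GCD as ℤ
import Data.Integer.Properties as ℤ
open import Data.List.Base using (map; allFin; tabulate)
open import Data.List.Properties using (map-tabulate)
open import Data.Nat.Base using (NonZero; zero; _+_; _*_; _<_; z≤n; z<s; >-nonZero)
open import Data.Nat.ListAction using (sum)
open import Data.Product using (∃; _,_; proj₁; proj₂; map₂)
open import Data.Rational using (_/_; ↥_; ↧_)
open import Data.Rational.Properties using (↥-/; ↧-/)
open import Data.Sum.Base as Sum using (_⊎_; inj₁; inj₂)
open import Data.Vec.Base using (_∷_; [])
import Data.Vec.Base as Vec
open import Data.Vec.Properties using (lookup∘tabulate; lookup⇒[]=; []=⇒lookup)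
open import Function.Base using (_∘_)
open import Relation.Nullary using (¬_; Dec; yes; no; does; contradiction)
open import Relation.Nullary.Decidable
  using (¬?; _×-dec_; _→-dec_; dec-true; decidable-stable; ¬¬-excluded-middle)
open import Relation.Unary using (Decidable)
open import Relation.Binary.PropositionalEquality

𝟙 : ∀ {a} {A : Set a} → Dec A → ℕ
𝟙 d = if does d then 1 else 0

𝟙-×-dec : ∀ {a b} {A : Set a} {B : Set b} (d : Dec A) (e : Dec B) → 𝟙 (d ×-dec e) ≡ 𝟙 d * 𝟙 e
𝟙-×-dec (yes _) (yes _) = refl
𝟙-×-dec (yes _) (no _)  = refl
𝟙-×-dec (no _)  _       = refl

sum-tabulate : ∀ {n} (f : Fin n → ℕ) → sum (tabulate f) ≡ ∑ f
sum-tabulate {zero}  f = refl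
sum-tabulate {suc n} f = cong (f zero +_) (sum-tabulate (f ∘ suc))

sum-map-allFin : ∀ {n} (f : Fin n → ℕ) → sum (map f (allFin n)) ≡ ∑ f
sum-map-allFin f = trans (cong sum (map-tabulate (λ i → i) f)) (sum-tabulate f)

∑-mono-≤ : ∀ {n} {f g : Fin n → ℕ} → (∀ i → f i ≤ g i) → ∑ f ≤ ∑ g
∑-mono-≤ {zero}  _   = z≤n
∑-mono-≤ {suc n} f≤g = +-mono-≤ (f≤g zero) (∑-mono-≤ (f≤g ∘ suc))

∑∑-distrib-+ : ∀ {n} (f g : Fin n → Fin n → ℕ) →
               ∑ (λ u → ∑ (λ w → f u w + g u w)) ≡ ∑ (λ u → ∑ (f u)) + ∑ (λ u → ∑ (g u))
∑∑-distrib-+ f g = trans (sum-cong-≗ (λ u → ∑-distrib-+ (f u) (g u)))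
                         (∑-distrib-+ (λ u → ∑ (f u)) (λ u → ∑ (g u)))

∣p∣≡∑𝟙 : ∀ {n} (p : Subset n) → ∣ p ∣ ≡ ∑ (λ i → 𝟙 (i ∈? p))
∣p∣≡∑𝟙 []            = refl
∣p∣≡∑𝟙 (inside  ∷ p) = cong suc (∣p∣≡∑𝟙 p)
∣p∣≡∑𝟙 (outside ∷ p) = ∣p∣≡∑𝟙 p

∑∑𝟙-rectangle : ∀ {n} (p q : Subset n) →
                ∑ (λ u → ∑ (λ w → 𝟙 (u ∈? p ×-dec w ∈? q))) ≡ ∣ p ∣ * ∣ q ∣
∑∑𝟙-rectangle p q = begin
  ∑ (λ u → ∑ (λ w → 𝟙 (u ∈? p ×-dec w ∈? q)))
    ≡⟨ sum-cong-≗ (λ u → sum-cong-≗ (λ w → 𝟙-×-dec (u ∈? p) (w ∈? q))) ⟩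
  ∑ (λ u → ∑ (λ w → 𝟙 (u ∈? p) * 𝟙 (w ∈? q)))
    ≡⟨ sum-cong-≗ (λ u → *-distribˡ-sum (𝟙 (u ∈? p)) (λ w → 𝟙 (w ∈? q))) ⟨
  ∑ (λ u → 𝟙 (u ∈? p) * ∑ (λ w → 𝟙 (w ∈? q)))
    ≡⟨ *-distribʳ-sum _ (λ u → 𝟙 (u ∈? p)) ⟨
  ∑ (λ u → 𝟙 (u ∈? p)) * ∑ (λ w → 𝟙 (w ∈? q))
    ≡⟨ cong₂ _*_ (∣p∣≡∑𝟙 p) (∣p∣≡∑𝟙 q) ⟨
  ∣ p ∣ * ∣ q ∣ ∎
  where open ≡-Reasoning

∣p∣≡∣p∩q∣+∣p∩∁q∣ : ∀ {n} (p q : Subset n) → ∣ p ∣ ≡ ∣ p ∩ q ∣ + ∣ p ∩ ∁ q ∣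
∣p∣≡∣p∩q∣+∣p∩∁q∣ []            []            = refl
∣p∣≡∣p∩q∣+∣p∩∁q∣ (outside ∷ p) (_       ∷ q) = ∣p∣≡∣p∩q∣+∣p∩∁q∣ p q
∣p∣≡∣p∩q∣+∣p∩∁q∣ (inside  ∷ p) (inside  ∷ q) = cong suc (∣p∣≡∣p∩q∣+∣p∩∁q∣ p q)
∣p∣≡∣p∩q∣+∣p∩∁q∣ (inside  ∷ p) (outside ∷ q) =
  trans (cong suc (∣p∣≡∣p∩q∣+∣p∩∁q∣ p q)) (sym (+-suc _ _))

∣p∣+∣∁p∣≡n : ∀ {n} (p : Subset n) → ∣ p ∣ + ∣ ∁ p ∣ ≡ n
∣p∣+∣∁p∣≡n p = trans (cong (∣ p ∣ +_) (∣∁p∣≡n∸∣p∣ p)) (m+[n∸m]≡n (∣p∣≤n p))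

two-elements⇒1<∣p∣ : ∀ {n} {p : Subset n} {u v} → u ∈ p → v ∈ p → u ≢ v → 1 < ∣ p ∣
two-elements⇒1<∣p∣ {p = p} {v = v} u∈p v∈p u≢v = ≤-<-trans
  (∈⇒0<∣∣ (x∈p∧x∉q⇒x∈p─q u∈p (x≢y⇒x∉⁅y⁆ u≢v)))
  (p∩q≢∅⇒∣p─q∣<∣p∣ p ⁅ v ⁆ (v , x∈p∩q⁺ (v∈p , x∈⁅x⁆ v)))

1<∣p∣⇒other-element : ∀ {n} {p : Subset n} v → 1 < ∣ p ∣ → ∃ λ t → t ∈ p × t ≢ v
1<∣p∣⇒other-element {p = p} v 1<∣p∣ with any? (λ t → t ∈? p ×-dec ¬? (t ≟ v))
... | yes found = found
... | no  none  =
  contradiction (≤-trans (p⊆q⇒∣p∣≤∣q∣ p⊆⁅v⁆) (≤-reflexive (∣⁅x⁆∣≡1 v))) (<⇒≱ 1<∣p∣)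
  where
  p⊆⁅v⁆ : ∀ {t} → t ∈ p → t ∈ ⁅ v ⁆
  p⊆⁅v⁆ {t} t∈p with t ≟ v
  ... | yes refl = x∈⁅x⁆ v
  ... | no  t≢v  = contradiction (t , t∈p , t≢v) none

∣p∣≡1⇒singleton : ∀ {n} {p : Subset n} → ∣ p ∣ ≡ 1 →
                  ∃ λ v → v ∈ p × (∀ {u} → u ∈ p → u ≡ v)
∣p∣≡1⇒singleton {n} {p} ∣p∣≡1 with nonempty? p
... | no  p≡∅       =
  contradiction (trans (sym (∣⊥∣≡0 n)) (trans (cong ∣_∣ (sym (Empty-unique p≡∅))) ∣p∣≡1)) λ ()
... | yes (v , v∈p) = v , v∈p , unique
  where
  unique : ∀ {u} → u ∈ p → u ≡ v
  unique {u} u∈p with u ≟ v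
  ... | yes u≡v = u≡v
  ... | no  u≢v =
    contradiction (subst (1 <_) ∣p∣≡1 (two-elements⇒1<∣p∣ u∈p v∈p u≢v)) (<-irrefl refl)

boundarySize≡∑∑ : ∀ {n} (H : Graph n) (X : Subset n) →
                  boundarySize H X ≡ ∑ (λ u → ∑ (λ w → crossing H X u w))
boundarySize≡∑∑ {n} H X =
  trans (sum-map-allFin (λ u → sum (map (crossing H X u) (allFin n))))
        (sum-cong-≗ (λ u → sum-map-allFin (crossing H X u)))

crossing-edge : ∀ {n} {H : Graph n} {X : Subset n} {u w} →
                u ∈ X × w ∉ X × adj H u w ≡ true → crossing H X u w ≡ 1
crossing-edge {X = X} {u} {w} (u∈X , w∉X , uw) with u ∈? X | w ∈? X
... | no u∉X | _       = contradiction u∈X u∉X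
... | yes _  | yes w∈X = contradiction w∈X w∉X
... | yes _  | no _    rewrite uw = refl

CrossingRectangle : ∀ {n} → Graph n → Subset n → Subset n → Subset n → Set
CrossingRectangle H X P Q = ∀ {u w} → u ∈ P → w ∈ Q → u ∈ X × w ∉ X × adj H u w ≡ true

two-rectangles-≤-boundarySize : ∀ {n} {H : Graph n} {X P₁ Q₁ P₂ Q₂ : Subset n} →
  CrossingRectangle H X P₁ Q₁ → CrossingRectangle H X P₂ Q₂ →
  (∀ {u w} → u ∈ P₁ → w ∈ Q₁ → ¬ (u ∈ P₂ × w ∈ Q₂)) →
  ∣ P₁ ∣ * ∣ Q₁ ∣ + ∣ P₂ ∣ * ∣ Q₂ ∣ ≤ boundarySize H X
two-rectangles-≤-boundarySize {H = H} {X} {P₁} {Q₁} {P₂} {Q₂} R₁ R₂ disjoint = begin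
  ∣ P₁ ∣ * ∣ Q₁ ∣ + ∣ P₂ ∣ * ∣ Q₂ ∣
    ≡⟨ cong₂ _+_ (∑∑𝟙-rectangle P₁ Q₁) (∑∑𝟙-rectangle P₂ Q₂) ⟨
  ∑ (λ u → ∑ (λ w → 𝟙 (u ∈? P₁ ×-dec w ∈? Q₁))) + ∑ (λ u → ∑ (λ w → 𝟙 (u ∈? P₂ ×-dec w ∈? Q₂)))
    ≡⟨ ∑∑-distrib-+ (λ u w → 𝟙 (u ∈? P₁ ×-dec w ∈? Q₁)) (λ u w → 𝟙 (u ∈? P₂ ×-dec w ∈? Q₂)) ⟨
  ∑ (λ u → ∑ (λ w → 𝟙 (u ∈? P₁ ×-dec w ∈? Q₁) + 𝟙 (u ∈? P₂ ×-dec w ∈? Q₂)))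
    ≤⟨ ∑-mono-≤ (λ u → ∑-mono-≤ (λ w → pointwise (u ∈? P₁ ×-dec w ∈? Q₁) (u ∈? P₂ ×-dec w ∈? Q₂))) ⟩
  ∑ (λ u → ∑ (λ w → crossing H X u w))
    ≡⟨ boundarySize≡∑∑ H X ⟨
  boundarySize H X ∎
  where
  open ≤-Reasoning
  pointwise : ∀ {u w} (d₁ : Dec (u ∈ P₁ × w ∈ Q₁)) (d₂ : Dec (u ∈ P₂ × w ∈ Q₂)) →
              𝟙 d₁ + 𝟙 d₂ ≤ crossing H X u w
  pointwise (yes (u∈P₁ , w∈Q₁)) (yes uw∈R₂) = ⊥-elim (disjoint u∈P₁ w∈Q₁ uw∈R₂)
  pointwise (yes (u∈P₁ , w∈Q₁)) (no _) =
    ≤-reflexive (sym (crossing-edge {H = H} (R₁ u∈P₁ w∈Q₁)))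
  pointwise (no _) (yes (u∈P₂ , w∈Q₂)) =
    ≤-reflexive (sym (crossing-edge {H = H} (R₂ u∈P₂ w∈Q₂)))
  pointwise (no _) (no _) = z≤n

rectangle-≤-boundarySize : ∀ {n} {H : Graph n} {X P Q : Subset n} →
  CrossingRectangle H X P Q → ∣ P ∣ * ∣ Q ∣ ≤ boundarySize H X
rectangle-≤-boundarySize {H = H} {X} {P} {Q} R = ≤-trans (m≤m+n _ _)
  (two-rectangles-≤-boundarySize {H = H} {X} {P} {Q} {⊥} {⊥} R
    (λ u∈⊥ _ → contradiction u∈⊥ ∉⊥) (λ _ _ (u∈⊥ , _) → ∉⊥ u∈⊥))

-- One boundary edge outside the rectangle would form a second, disjoint rectangle.
rectangle-contains-boundary : ∀ {n} {H : Graph n} {X P Q : Subset n} →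
  CrossingRectangle H X P Q → boundarySize H X ≤ ∣ P ∣ * ∣ Q ∣ →
  ∀ {a b} → a ∈ X → b ∉ X → adj H a b ≡ true → a ∈ P × b ∈ Q
rectangle-contains-boundary {H = H} {X} {P} {Q} R ∂X≤PQ {a} {b} a∈X b∉X ab
  with a ∈? P ×-dec b ∈? Q
... | yes ab∈P×Q = ab∈P×Q
... | no  ab∉P×Q = contradiction (≤-trans PQ+1≤∂X ∂X≤PQ) (m+1+n≰m (∣ P ∣ * ∣ Q ∣))
  where
  edge : CrossingRectangle H X ⁅ a ⁆ ⁅ b ⁆
  edge u∈⁅a⁆ w∈⁅b⁆ rewrite x∈⁅y⁆⇒x≡y a u∈⁅a⁆ | x∈⁅y⁆⇒x≡y b w∈⁅b⁆ = a∈X , b∉X , ab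
  disjoint : ∀ {u w} → u ∈ P → w ∈ Q → ¬ (u ∈ ⁅ a ⁆ × w ∈ ⁅ b ⁆)
  disjoint u∈P w∈Q (u∈⁅a⁆ , w∈⁅b⁆) rewrite x∈⁅y⁆⇒x≡y a u∈⁅a⁆ | x∈⁅y⁆⇒x≡y b w∈⁅b⁆ =
    ab∉P×Q (u∈P , w∈Q)
  PQ+1≤∂X : ∣ P ∣ * ∣ Q ∣ + 1 ≤ boundarySize H X
  PQ+1≤∂X = subst (λ k → ∣ P ∣ * ∣ Q ∣ + k ≤ boundarySize H X)
                  (cong₂ _*_ (∣⁅x⁆∣≡1 a) (∣⁅x⁆∣≡1 b))
                  (two-rectangles-≤-boundarySize {H = H} {X} {P} {Q} R edge disjoint)

m*n≤m⇒n≡1 : ∀ {m n} → 0 < m → 0 < n → m * n ≤ m → n ≡ 1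
m*n≤m⇒n≡1 {suc m} _ 0<n m*n≤m =
  ≤-antisym (*-cancelˡ-≤ (suc m) (≤-trans m*n≤m (≤-reflexive (sym (*-identityʳ (suc m)))))) 0<n

m*n≤n⇒m≡1 : ∀ {m n} → 0 < m → 0 < n → m * n ≤ n → m ≡ 1
m*n≤n⇒m≡1 {m} {n} 0<m 0<n m*n≤n = m*n≤m⇒n≡1 0<n 0<m (≤-trans (≤-reflexive (*-comm n m)) m*n≤n)

+-squeeze : ∀ {m n p q} → m ≤ p → n ≤ q → p + q ≤ m + n → p ≤ m × q ≤ n
+-squeeze {m} {n} {p} {q} m≤p n≤q p+q≤m+n =
  +-cancelʳ-≤ n p m (≤-trans (+-monoʳ-≤ p n≤q) p+q≤m+n) ,
  +-cancelˡ-≤ m q n (≤-trans (+-monoˡ-≤ q m≤p) p+q≤m+n)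

m≤n⇒5≤m+n⇒1<n : ∀ {m n} → m ≤ n → 5 ≤ m + n → 1 < n
m≤n⇒5≤m+n⇒1<n {m} {n} m≤n 5≤m+n with 1 <? n
... | yes 1<n = 1<n
... | no  1≮n = contradiction (≤-trans 5≤m+n (+-mono-≤ (≤-trans m≤n n≤1) n≤1)) (m+1+n≰m 2)
  where n≤1 = ≮⇒≥ 1≮n

-- With a, b, c, d the sizes of X ∩ C, X ∩ ∁C, ∁X ∩ C, ∁X ∩ ∁C.
cross-products≤sides⇒singleton : ∀ a b c d → 5 ≤ (a + b) + (c + d) →
  0 < a + b → 0 < a + c → 0 < c + d → 0 < b + d →
  a * d + b * c ≤ a + b → a * d + b * c ≤ c + d → a + c ≡ 1 ⊎ b + d ≡ 1
cross-products≤sides⇒singleton zero b c d _ 0<b 0<c _ _ bc≤b _ = inj₁ (m*n≤m⇒n≡1 0<b 0<c bc≤b)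
cross-products≤sides⇒singleton (suc a) b zero d _ _ _ 0<d _ _ ad+b0≤d =
  inj₁ (trans (+-identityʳ (suc a)) (m*n≤n⇒m≡1 z<s 0<d (≤-trans (m≤m+n _ _) ad+b0≤d)))
cross-products≤sides⇒singleton (suc a) zero (suc c) d _ _ _ _ 0<d ad+0≤a+0 _ =
  inj₂ (m*n≤m⇒n≡1 z<s 0<d (+-cancelʳ-≤ 0 _ _ ad+0≤a+0))
cross-products≤sides⇒singleton (suc a) (suc b) (suc c) zero _ _ _ _ _ _ a0+bc≤c+0 =
  inj₂ (trans (+-identityʳ (suc b))
    (m*n≤n⇒m≡1 z<s z<s (≤-trans (m≤n+m _ _) (≤-trans a0+bc≤c+0 (≤-reflexive (+-identityʳ _))))))
cross-products≤sides⇒singleton (suc a) (suc b) (suc c) (suc d) 5≤n _ _ _ _ ≤a+b ≤c+d =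
  contradiction (≤-trans 5≤n (+-mono-≤ (+-mono-≤ a≤1 b≤1) (+-mono-≤ c≤1 d≤1))) (m+1+n≰m 4)
  where
  ad≤a,bc≤b = +-squeeze (m≤m*n (suc a) (suc d)) (m≤m*n (suc b) (suc c)) ≤a+b
  ad≤d,bc≤c = +-squeeze (m≤n*m (suc d) (suc a)) (m≤n*m (suc c) (suc b))
                        (≤-trans ≤c+d (≤-reflexive (+-comm (suc c) (suc d))))
  d≤1 = ≤-reflexive (m*n≤m⇒n≡1 z<s z<s (proj₁ ad≤a,bc≤b))
  c≤1 = ≤-reflexive (m*n≤m⇒n≡1 z<s z<s (proj₂ ad≤a,bc≤b))
  a≤1 = ≤-reflexive (m*n≤n⇒m≡1 z<s z<s (proj₁ ad≤d,bc≤c))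
  b≤1 = ≤-reflexive (m*n≤n⇒m≡1 z<s z<s (proj₂ ad≤d,bc≤c))

CompleteAcross : ∀ {n} → Graph n → Subset n → Set
CompleteAcross H C = ∀ {a b} → a ∈ C → b ∉ C → adj H a b ≡ true

completeAcross-∁ : ∀ {n} {H : Graph n} {C : Subset n} → CompleteAcross H C → CompleteAcross H (∁ C)
completeAcross-∁ {H = H} join a∈∁C b∉∁C =
  trans (Graph.sym H _ _) (join (x∉∁p⇒x∈p b∉∁C) (x∈∁p⇒x∉p a∈∁C))

∣∂X∣≡min⇒join-side-singleton : ∀ {n} {H : Graph n} {X C : Subset n} →
  5 ≤ n → boundarySize H X ≡ minSide X → Nonempty X → Nonempty (∁ X) →
  Nonempty C → Nonempty (∁ C) → CompleteAcross H C → ∣ C ∣ ≡ 1 ⊎ ∣ ∁ C ∣ ≡ 1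
∣∂X∣≡min⇒join-side-singleton {n} {H} {X} {C} 5≤n ∂X≡min
                              (_ , x∈X) (_ , y∈∁X) (_ , c∈C) (_ , d∈∁C) join =
  Sum.map (trans ∣C∣≡a+c) (trans ∣∁C∣≡b+d) (cross-products≤sides⇒singleton a b c d
    (subst (5 ≤_) (trans (sym (∣p∣+∣∁p∣≡n X)) (cong₂ _+_ ∣X∣≡a+b ∣∁X∣≡c+d)) 5≤n)
    (sizeOf ∣X∣≡a+b x∈X) (sizeOf ∣C∣≡a+c c∈C) (sizeOf ∣∁X∣≡c+d y∈∁X) (sizeOf ∣∁C∣≡b+d d∈∁C)
    (≤-trans ad+bc≤min (≤-trans (m⊓n≤m _ _) (≤-reflexive ∣X∣≡a+b)))
    (≤-trans ad+bc≤min (≤-trans (m⊓n≤n _ _) (≤-reflexive ∣∁X∣≡c+d))))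
  where
  a = ∣ X ∩ C ∣
  b = ∣ X ∩ ∁ C ∣
  c = ∣ ∁ X ∩ C ∣
  d = ∣ ∁ X ∩ ∁ C ∣
  ∣X∣≡a+b : ∣ X ∣ ≡ a + b
  ∣X∣≡a+b = ∣p∣≡∣p∩q∣+∣p∩∁q∣ X C
  ∣∁X∣≡c+d : ∣ ∁ X ∣ ≡ c + d
  ∣∁X∣≡c+d = ∣p∣≡∣p∩q∣+∣p∩∁q∣ (∁ X) C
  ∣C∣≡a+c : ∣ C ∣ ≡ a + c
  ∣C∣≡a+c = trans (∣p∣≡∣p∩q∣+∣p∩∁q∣ C X)
                  (cong₂ _+_ (cong ∣_∣ (∩-comm C X)) (cong ∣_∣ (∩-comm C (∁ X))))
  ∣∁C∣≡b+d : ∣ ∁ C ∣ ≡ b + d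
  ∣∁C∣≡b+d = trans (∣p∣≡∣p∩q∣+∣p∩∁q∣ (∁ C) X)
                   (cong₂ _+_ (cong ∣_∣ (∩-comm (∁ C) X)) (cong ∣_∣ (∩-comm (∁ C) (∁ X))))
  sizeOf : ∀ {p : Subset n} {k i} → ∣ p ∣ ≡ k → i ∈ p → 0 < k
  sizeOf ∣p∣≡k i∈p = subst (0 <_) ∣p∣≡k (∈⇒0<∣∣ i∈p)
  R₁ : CrossingRectangle H X (X ∩ C) (∁ X ∩ ∁ C)
  R₁ u∈X∩C w∈∁X∩∁C with x∈p∩q⁻ X C u∈X∩C | x∈p∩q⁻ (∁ X) (∁ C) w∈∁X∩∁C
  ... | u∈X , u∈C | w∈∁X , w∈∁C = u∈X , x∈∁p⇒x∉p w∈∁X , join u∈C (x∈∁p⇒x∉p w∈∁C)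
  R₂ : CrossingRectangle H X (X ∩ ∁ C) (∁ X ∩ C)
  R₂ {u} {w} u∈X∩∁C w∈∁X∩C with x∈p∩q⁻ X (∁ C) u∈X∩∁C | x∈p∩q⁻ (∁ X) C w∈∁X∩C
  ... | u∈X , u∈∁C | w∈∁X , w∈C =
    u∈X , x∈∁p⇒x∉p w∈∁X , trans (Graph.sym H u w) (join w∈C (x∈∁p⇒x∉p u∈∁C))
  disjoint : ∀ {u w} → u ∈ X ∩ C → w ∈ ∁ X ∩ ∁ C → ¬ (u ∈ X ∩ ∁ C × w ∈ ∁ X ∩ C)
  disjoint u∈X∩C _ (u∈X∩∁C , _) =
    x∈∁p⇒x∉p (proj₂ (x∈p∩q⁻ X (∁ C) u∈X∩∁C)) (proj₂ (x∈p∩q⁻ X C u∈X∩C))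
  ad+bc≤min : a * d + b * c ≤ minSide X
  ad+bc≤min = ≤-trans (two-rectangles-≤-boundarySize {H = H} R₁ R₂ disjoint) (≤-reflexive ∂X≡min)

join-side-singleton⇒dominating : ∀ {n} {H : Graph n} {C : Subset n} →
  CompleteAcross H C → ∣ C ∣ ≡ 1 → ∃ (Dominating H)
join-side-singleton⇒dominating join ∣C∣≡1 with ∣p∣≡1⇒singleton ∣C∣≡1
... | v , v∈C , unique = v , λ u u≢v → join v∈C (u≢v ∘ unique)

Separates : ∀ {n} → Graph n → Fin n → Subset n → Set
Separates H v X = (∃ λ s → s ∈ X × s ≢ v) × (∃ λ t → t ∉ X × t ≢ v)
                × (∀ a b → a ∈ X → b ∉ X → a ≢ v → b ≢ v → adj H a b ≢ true)

module _ {n} {H : Graph n} {X : Subset n} {v : Fin n}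
         (5≤n : 5 ≤ n) (∂X≡min : boundarySize H X ≡ minSide X)
         (X≢∅ : Nonempty X) (∁X≢∅ : Nonempty (∁ X)) (dominating : Dominating H v) where

  private
    5≤∣X∣+∣∁X∣ : 5 ≤ ∣ X ∣ + ∣ ∁ X ∣
    5≤∣X∣+∣∁X∣ = subst (5 ≤_) (sym (∣p∣+∣∁p∣≡n X)) 5≤n

  dominating∉⇒separates : v ∉ X → Separates H v X
  dominating∉⇒separates v∉X =
    let s , s∈X        = X≢∅
        t , t∈∁X , t≢v = 1<∣p∣⇒other-element v 1<∣∁X∣
    in (s , s∈X , ∈X⇒≢v s∈X) , (t , x∈∁p⇒x∉p t∈∁X , t≢v) , separated
    where
    ∈X⇒≢v : ∀ {u} → u ∈ X → u ≢ v
    ∈X⇒≢v u∈X refl = v∉X u∈X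
    star : CrossingRectangle H X X ⁅ v ⁆
    star {u} u∈X w∈⁅v⁆ rewrite x∈⁅y⁆⇒x≡y v w∈⁅v⁆ =
      u∈X , v∉X , trans (Graph.sym H u v) (dominating u (∈X⇒≢v u∈X))
    area : ∣ X ∣ * ∣ ⁅ v ⁆ ∣ ≡ ∣ X ∣
    area = trans (cong (∣ X ∣ *_) (∣⁅x⁆∣≡1 v)) (*-identityʳ _)
    ∣X∣≤∂X : ∣ X ∣ ≤ boundarySize H X
    ∣X∣≤∂X = subst (_≤ boundarySize H X) area (rectangle-≤-boundarySize {H = H} star)
    ∂X≤area : boundarySize H X ≤ ∣ X ∣ * ∣ ⁅ v ⁆ ∣
    ∂X≤area = ≤-trans (≤-reflexive ∂X≡min) (≤-trans (m⊓n≤m _ _) (≤-reflexive (sym area)))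
    1<∣∁X∣ : 1 < ∣ ∁ X ∣
    1<∣∁X∣ = m≤n⇒5≤m+n⇒1<n (≤-trans ∣X∣≤∂X (≤-trans (≤-reflexive ∂X≡min) (m⊓n≤n _ _)))
                           5≤∣X∣+∣∁X∣
    separated : ∀ a b → a ∈ X → b ∉ X → a ≢ v → b ≢ v → adj H a b ≢ true
    separated a b a∈X b∉X _ b≢v ab =
      b≢v (x∈⁅y⁆⇒x≡y v (proj₂ (rectangle-contains-boundary {H = H} star ∂X≤area a∈X b∉X ab)))

  dominating∈⇒separates : v ∈ X → Separates H v X
  dominating∈⇒separates v∈X =
    let s , s∈X , s≢v = 1<∣p∣⇒other-element v 1<∣X∣
        t , t∈∁X      = ∁X≢∅
    in (s , s∈X , s≢v) , (t , x∈∁p⇒x∉p t∈∁X , ∉X⇒≢v (x∈∁p⇒x∉p t∈∁X)) , separated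
    where
    ∉X⇒≢v : ∀ {u} → u ∉ X → u ≢ v
    ∉X⇒≢v u∉X refl = u∉X v∈X
    star : CrossingRectangle H X ⁅ v ⁆ (∁ X)
    star {w = w} u∈⁅v⁆ w∈∁X rewrite x∈⁅y⁆⇒x≡y v u∈⁅v⁆ =
      v∈X , x∈∁p⇒x∉p w∈∁X , dominating w (∉X⇒≢v (x∈∁p⇒x∉p w∈∁X))
    area : ∣ ⁅ v ⁆ ∣ * ∣ ∁ X ∣ ≡ ∣ ∁ X ∣
    area = trans (cong (_* ∣ ∁ X ∣) (∣⁅x⁆∣≡1 v)) (*-identityˡ _)
    ∣∁X∣≤∂X : ∣ ∁ X ∣ ≤ boundarySize H X
    ∣∁X∣≤∂X = subst (_≤ boundarySize H X) area (rectangle-≤-boundarySize {H = H} star)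
    ∂X≤area : boundarySize H X ≤ ∣ ⁅ v ⁆ ∣ * ∣ ∁ X ∣
    ∂X≤area = ≤-trans (≤-reflexive ∂X≡min) (≤-trans (m⊓n≤n _ _) (≤-reflexive (sym area)))
    1<∣X∣ : 1 < ∣ X ∣
    1<∣X∣ = m≤n⇒5≤m+n⇒1<n (≤-trans ∣∁X∣≤∂X (≤-trans (≤-reflexive ∂X≡min) (m⊓n≤m _ _)))
                          (subst (5 ≤_) (+-comm ∣ X ∣ _) 5≤∣X∣+∣∁X∣)
    separated : ∀ a b → a ∈ X → b ∉ X → a ≢ v → b ≢ v → adj H a b ≢ true
    separated a b a∈X b∉X a≢v _ ab =
      a≢v (x∈⁅y⁆⇒x≡y v (proj₁ (rectangle-contains-boundary {H = H} star ∂X≤area a∈X b∉X ab)))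

  dominating⇒separates : Separates H v X
  dominating⇒separates with v ∈? X
  ... | yes v∈X = dominating∈⇒separates v∈X
  ... | no  v∉X = dominating∉⇒separates v∉X

∣∂X∣≡min⇒separating-dominator : ∀ {n} {H : Graph n} {X C : Subset n} →
  5 ≤ n → boundarySize H X ≡ minSide X → Nonempty X → Nonempty (∁ X) →
  Nonempty C → Nonempty (∁ C) → CompleteAcross H C →
  ∃ λ v → Dominating H v × Separates H v X
∣∂X∣≡min⇒separating-dominator {H = H} 5≤n ∂X≡min X≢∅ ∁X≢∅ C≢∅ ∁C≢∅ join =
  let v , dominating =
        Sum.[ join-side-singleton⇒dominating {H = H} join
            , join-side-singleton⇒dominating {H = H} (completeAcross-∁ {H = H} join) ]′
            (∣∂X∣≡min⇒join-side-singleton {H = H} 5≤n ∂X≡min X≢∅ ∁X≢∅ C≢∅ ∁C≢∅ join)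
  in v , dominating , dominating⇒separates {H = H} 5≤n ∂X≡min X≢∅ ∁X≢∅ dominating

separates⇒disconnected : ∀ {m} {H : Graph (suc m)} {v X} →
                         Separates H v X → Disconnected (deleteVertex H v)
separates⇒disconnected {H = H} {v} {X} ((s , s∈X , s≢v) , (t , t∉X , t≢v) , separated) connected =
  t∉X (subst (_∈ X) (punchIn-punchOut v≢t)
        (stays-in-X (connected (punchOut v≢s) (punchOut v≢t))
                    (subst (_∈ X) (sym (punchIn-punchOut v≢s)) s∈X)))
  where
  v≢s = s≢v ∘ sym
  v≢t = t≢v ∘ sym
  stays-in-X : ∀ {i j} → Reachable (deleteVertex H v) i j → punchIn v i ∈ X → punchIn v j ∈ X
  stays-in-X here                 i∈X = i∈X
  stays-in-X (step {v = k} ik kj) i∈X with punchIn v k ∈? X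
  ... | yes k∈X = stays-in-X kj k∈X
  ... | no  k∉X = contradiction ik (separated _ _ i∈X k∉X (punchInᵢ≢i v _) (punchInᵢ≢i v k))

dominating? : ∀ {n} (H : Graph n) v → Dec (Dominating H v)
dominating? H v = all? λ u → ¬? (u ≟ v) →-dec (adj H v u Bool.≟ true)

separates? : ∀ {n} (H : Graph n) v X → Dec (Separates H v X)
separates? H v X =
  any? (λ s → s ∈? X ×-dec ¬? (s ≟ v)) ×-dec
  any? (λ t → ¬? (t ∈? X) ×-dec ¬? (t ≟ v)) ×-dec
  all? λ a → all? λ b →
    a ∈? X →-dec ¬? (b ∈? X) →-dec ¬? (a ≟ v) →-dec ¬? (b ≟ v) →-dec ¬? (adj H a b Bool.≟ true)

subsetOf : ∀ {n} {P : Fin n → Set} → Decidable P → Subset n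
subsetOf P? = Vec.tabulate (does ∘ P?)

∈-subsetOf⁺ : ∀ {n} {P : Fin n → Set} (P? : Decidable P) {i} → P i → i ∈ subsetOf P?
∈-subsetOf⁺ P? {i} Pi =
  lookup⇒[]= i _ (trans (lookup∘tabulate (does ∘ P?) i) (dec-true (P? i) Pi))

∈-subsetOf⁻ : ∀ {n} {P : Fin n → Set} (P? : Decidable P) {i} → i ∈ subsetOf P? → P i
∈-subsetOf⁻ P? {i} i∈P with P? i | trans (sym (lookup∘tabulate (does ∘ P?) i)) ([]=⇒lookup i∈P)
... | yes Pi | _ = Pi
... | no  _  | ()

Reachable-snoc : ∀ {n} {G : Graph n} {u a b} →
                 Reachable G u a → adj G a b ≡ true → Reachable G u b
Reachable-snoc here       ab = step ab here
Reachable-snoc (step e r) ab = step e (Reachable-snoc r ab)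

Cut : ∀ {n} → Graph n → Subset n → Set
Cut G C = Nonempty C × Nonempty (∁ C) × (∀ {a b} → a ∈ C → b ∉ C → adj G a b ≢ true)

unreachable⇒cut : ∀ {n} {G : Graph n} {u w} → ¬ Reachable G u w →
                  (reachable? : ∀ z → Dec (Reachable G u z)) → Cut G (subsetOf reachable?)
unreachable⇒cut ¬uw reachable? =
  (_ , ∈-subsetOf⁺ reachable? here) ,
  (_ , x∉p⇒x∈∁p (¬uw ∘ ∈-subsetOf⁻ reachable?)) ,
  λ a∈C b∉C ab → b∉C (∈-subsetOf⁺ reachable? (Reachable-snoc (∈-subsetOf⁻ reachable? a∈C) ab))

¬¬-∀-Fin : ∀ {n} {P : Fin n → Set} → (∀ i → ¬ ¬ P i) → ¬ ¬ (∀ i → P i)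
¬¬-∀-Fin {zero}  _   ¬∀P = ¬∀P λ ()
¬¬-∀-Fin {suc n} ¬¬P ¬∀P = ¬¬P zero λ P₀ →
  ¬¬-∀-Fin (¬¬P ∘ suc) λ P₊ → ¬∀P λ { zero → P₀ ; (suc i) → P₊ i }

disconnected⇒¬¬cut : ∀ {n} {G : Graph n} → Disconnected G → ¬ ¬ ∃ (Cut G)
disconnected⇒¬¬cut disconnected noCut =
  ¬¬-∀-Fin (λ u → ¬¬-∀-Fin λ w ¬uw →
    ¬¬-∀-Fin (λ _ → ¬¬-excluded-middle) λ reachable? → noCut (_ , unreachable⇒cut ¬uw reachable?))
  disconnected

cut⇒complement-completeAcross : ∀ {n} {G : Graph n} {C} → Cut G C → CompleteAcross (complement G) C
cut⇒complement-completeAcross {G = G} (_ , _ , noEdge) {a} {b} a∈C b∉C with a ≟ b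
... | yes refl = contradiction a∈C b∉C
... | no  _    = cong not (Bool.¬-not (noEdge a∈C b∉C))

+n/d≡1⇒n≡d : ∀ n d .{{_ : NonZero d}} → (ℤ.+ n) / d ≡ 1ℚ → n ≡ d
+n/d≡1⇒n≡d n d n/d≡1 = ℤ.+-injective (begin
  ℤ.+ n               ≡⟨ ↥-/ (ℤ.+ n) d ⟨
  ↥ (ℤ.+ n / d) ℤ.* g ≡⟨ cong (λ q → ↥ q ℤ.* g) n/d≡1 ⟩
  ↥ 1ℚ ℤ.* g          ≡⟨ cong (λ q → ↧ q ℤ.* g) n/d≡1 ⟨
  ↧ (ℤ.+ n / d) ℤ.* g ≡⟨ ↧-/ (ℤ.+ n) d ⟩
  ℤ.+ d               ∎)
  where
  open ≡-Reasoning
  g = ℤ.gcd (ℤ.+ n) (ℤ.+ d)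

lemma4p1 : ∀ (m : ℕ) → 5 ≤ suc m → (G : Graph (suc m)) → Disconnected G
         → IsoNumberIs (complement G) 1ℚ
         → ∃[ v ] (Dominating (complement G) v × Disconnected (deleteVertex (complement G) v))
lemma4p1 m 5≤n G disconnected (_ , X , X≢∅ , ∁X≢∅ , iX≡1) =
  map₂ (map₂ (separates⇒disconnected {H = H}))
    (decidable-stable separatingDominator? λ none →
      disconnected⇒¬¬cut disconnected λ (C , cut@(C≢∅ , ∁C≢∅ , _)) →
        none (∣∂X∣≡min⇒separating-dominator {H = H} 5≤n ∂X≡min X≢∅ ∁X≢∅ C≢∅ ∁C≢∅
               (cut⇒complement-completeAcross {G = G} cut)))
  where
  H = complement G
  ∂X≡min : boundarySize H X ≡ minSide X
  ∂X≡min = +n/d≡1⇒n≡d _ _ {{>-nonZero (minSide-pos X X≢∅ ∁X≢∅)}} iX≡1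
  separatingDominator? : Dec (∃ λ v → Dominating H v × Separates H v X)
  separatingDominator? = any? λ v → dominating? H v ×-dec separates? H v X
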